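{- Let $F_0$ be the value of a $\beta$-approximate solution for $k$-center with a mergeable constraint on an instance $(P,d,k)$, and let $r_1^*$ be the largest radius of an optimal $k$-min-sum-radii solution with the same constraint on the same instance. Let $\varepsilon>0$. Then the set $R=\{(1+\varepsilon)^j\frac{F_0}{\beta}: j\in\mathbb{Z}_{\ge0},\ j\le\lceil\log_{1+\varepsilon}(\beta k)\rceil\}$ contains a value $\tilde r_1$ with $r_1^*\le\tilde r_1\le(1+\varepsilon)r_1^*$.
   Context: Solutions consist of at most $k$ centers $\mathscr{C}\subseteq P$ and an assignment $\sigma\colon P\to\mathscr{C}$; the radius of cluster $\sigma^{ -1}(c)$ is $\max_{p\in\sigma^{ -1}(c)}d(p,c)$. A constraint is a predicate on clusterings; it is mergeable if feasibility is preserved when two clusters are united and assigned to an arbitrary point of their union. Constrained $k$-center minimizes the maximum radius over feasible solutions; constrained $k$-min-sum-radii minimizes the sum of radii over feasible solutions. A $\beta$-approximate solution has value at most $\beta$ times the optimum.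
   Formalization: The metric d and the parameters β and ε take rational values instead of real ones. -}

module Defs where

open import Data.Nat as ℕ using (ℕ; zero; suc)
open import Data.Fin using (Fin)
open import Data.Fin.Subset using (Subset; _∈_; _∉_; ∣_∣; _∪_; _─_; ⁅_⁆)
open import Data.Fin.Subset.Properties using (_∈?_)
open import Data.Fin.Properties using () renaming (_≟_ to _≟ᶠ_)
open import Data.Rational using (ℚ; 0ℚ; 1ℚ; _+_; _*_; _⊔_; _≤_; _<_)
open import Data.List using (List; foldr; map)
open import Data.List.Base using (allFin)
open import Data.Product using (_×_; Σ; _,_)
open import Data.Sum using (_⊎_)
open import Relation.Nullary using (¬_; yes; no)
open import Relation.Binary.PropositionalEquality using (_≡_; _≢_)

_^ℚ_ : ℚ → ℕ → ℚ
q ^ℚ zero  = 1ℚ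
q ^ℚ suc j = q * (q ^ℚ j)

-- maximum / sum over all points of Fin n (max of the empty family is 0)
maxFin : ∀ {n} → (Fin n → ℚ) → ℚ
maxFin {n} f = foldr _⊔_ 0ℚ (map f (allFin n))

sumFin : ∀ {n} → (Fin n → ℚ) → ℚ
sumFin {n} f = foldr _+_ 0ℚ (map f (allFin n))

record IsMetric {n : ℕ} (d : Fin n → Fin n → ℚ) : Set where
  field
    nonneg : ∀ p q → 0ℚ ≤ d p q
    refl0  : ∀ p → d p p ≡ 0ℚ
    sep    : ∀ p q → d p q ≡ 0ℚ → p ≡ q
    symm   : ∀ p q → d p q ≡ d q p
    triang : ∀ p q r → d p r ≤ d p q + d q r

record Solution (n k : ℕ) : Set where
  constructor mkSol
  field
    centers : Subset n
    σ       : Fin n → Fin n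
    σ∈C     : ∀ p → σ p ∈ centers
    atMostK : ∣ centers ∣ ℕ.≤ k
open Solution public

contrib : ∀ {n k} → (Fin n → Fin n → ℚ) → Solution n k → Fin n → Fin n → ℚ
contrib d S c p with σ S p ≟ᶠ c
... | yes _ = d p c
... | no _  = 0ℚ

-- radius of the cluster σ⁻¹(c): max_{p ∈ σ⁻¹(c)} d(p,c)  (0 if the cluster is empty)
radius : ∀ {n k} → (Fin n → Fin n → ℚ) → Solution n k → Fin n → ℚ
radius d S c = maxFin (contrib d S c)

centerRadius : ∀ {n k} → (Fin n → Fin n → ℚ) → Solution n k → Fin n → ℚ
centerRadius d S c with c ∈? centers S
... | yes _ = radius d S c
... | no _  = 0ℚ

maxRadius : ∀ {n k} → (Fin n → Fin n → ℚ) → Solution n k → ℚ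
maxRadius d S = maxFin (centerRadius d S)

sumRadii : ∀ {n k} → (Fin n → Fin n → ℚ) → Solution n k → ℚ
sumRadii d S = sumFin (centerRadius d S)

Constraint : ℕ → ℕ → Set₁
Constraint n k = Solution n k → Set

-- The merged solution is given by any S' with these centers and assignment
-- (the proof fields of a solution are irrelevant to its identity).
IsMerge : ∀ {n k} → Solution n k → Fin n → Fin n → Fin n → Solution n k → Set
IsMerge S c₁ c₂ c S' =
  (centers S' ≡ ((centers S ─ ⁅ c₁ ⁆) ─ ⁅ c₂ ⁆) ∪ ⁅ c ⁆) ×
  (∀ p → ((σ S p ≡ c₁ ⊎ σ S p ≡ c₂) → σ S' p ≡ c) ×
         ((σ S p ≢ c₁ × σ S p ≢ c₂) → σ S' p ≡ σ S p))

Mergeable : ∀ {n k} → Constraint n k → Set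
Mergeable {n} {k} feas =
  ∀ (S : Solution n k) (c₁ c₂ c : Fin n) → feas S →
    c₁ ∈ centers S → c₂ ∈ centers S → c₁ ≢ c₂ →
    (σ S c ≡ c₁ ⊎ σ S c ≡ c₂) →
    ∀ (S' : Solution n k) → IsMerge S c₁ c₂ c S' → feas S'

OptimalKCenter : ∀ {n k} → (Fin n → Fin n → ℚ) → Constraint n k → Solution n k → Set
OptimalKCenter {n} {k} d feas S = feas S × (∀ (T : Solution n k) → feas T → maxRadius d S ≤ maxRadius d T)

OptimalMSR : ∀ {n k} → (Fin n → Fin n → ℚ) → Constraint n k → Solution n k → Set
OptimalMSR {n} {k} d feas S = feas S × (∀ (T : Solution n k) → feas T → sumRadii d S ≤ sumRadii d T)

-- S is a β-approximate solution for constrained k-center: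
-- feasible, with value at most β times the value of every feasible solution
-- (equivalently, at most β times the optimum)
BetaApproxKCenter : ∀ {n k} → (Fin n → Fin n → ℚ) → Constraint n k → ℚ → Solution n k → Set
BetaApproxKCenter {n} {k} d feas β S = feas S × (∀ (T : Solution n k) → feas T → maxRadius d S ≤ β * maxRadius d T)

-- J = ⌈log_b x⌉ for x ≥ 1, b > 1: the least natural number J with x ≤ b^J
IsCeilLog : ℚ → ℚ → ℕ → Set
IsCeilLog b x J = (x ≤ b ^ℚ J) × (∀ (j : ℕ) → x ≤ b ^ℚ j → J ℕ.≤ j)

-- The MSR optimum is feasible for k-center, so F₀ ≤ β r₁*; the k-center solution
-- is feasible for MSR and has at most k clusters of radius ≤ F₀, so
-- r₁* ≤ (optimal sum of radii) ≤ k F₀. Hence r₁* lies in [F₀/β, (βk) F₀/β], which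
-- the grid (1+ε)ʲ F₀/β, j ≤ ⌈log₁₊ε (βk)⌉, covers, and the first grid point
-- above r₁* exceeds it by at most a factor 1+ε.
module Submission where

open import Defs
open import Data.Nat as ℕ using (ℕ; zero; suc)
import Data.Nat.Properties as ℕP
open import Data.Nat.Coprimality using (1-coprimeTo) renaming (sym to coprime-sym)
open import Data.Fin using (Fin; zero; suc)
open import Data.Fin.Subset using (Subset; _∉_; ∣_∣; inside; outside)
open import Data.Fin.Subset.Properties using (_∈?_; drop-there)
open import Data.Integer as ℤ using (+_)
import Data.Integer.Properties as ℤP
open import Data.Rational using (ℚ; 0ℚ; 1ℚ; _+_; _*_; _÷_; _/_; _≤_; _<_; _⊔_; 1/_; NonZero; Positive; nonNegative; positive)
open import Data.Rational.Properties
open import Data.List using (foldr; map; allFin)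
open import Data.List.Properties using (map-tabulate)
open import Data.Product using (Σ; _×_; _,_; proj₁)
open import Data.Vec using ([]; _∷_)
open import Function using (_∘_; id)
open import Relation.Nullary using (yes; no; contradiction)
open import Relation.Binary.PropositionalEquality using (_≡_; refl; sym; cong; trans; subst; module ≡-Reasoning)

private
  variable
    n k : ℕ

[1+m]/1≡1+m/1 : ∀ m → + suc m / 1 ≡ 1ℚ + + m / 1
[1+m]/1≡1+m/1 m = begin
  + suc m / 1                ≡⟨ cong (λ i → (+ 1 ℤ.+ i) / 1) (sym (ℤP.*-identityʳ (+ m))) ⟩
  -- once m / 1 is in normal form, 1ℚ + m / 1 unfolds to this expression
  (+ 1 ℤ.+ + m ℤ.* + 1) / 1  ≡⟨ cong (λ q → 1ℚ + q) (sym (normalize-coprime (coprime-sym (1-coprimeTo m)))) ⟩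
  1ℚ + + m / 1               ∎
  where open ≡-Reasoning

0≤m/1 : ∀ m → 0ℚ ≤ + m / 1
0≤m/1 m = nonNegative⁻¹ (+ m / 1) {{normalize-nonNeg m 1}}

p≤q+p : ∀ {p q} → 0ℚ ≤ q → p ≤ q + p
p≤q+p {p} {q} q≥0 = subst (_≤ q + p) (+-identityˡ p) (+-monoˡ-≤ p q≥0)

p≤p+q : ∀ {p q} → 0ℚ ≤ q → p ≤ p + q
p≤p+q {p} {q} q≥0 = subst (_≤ p + q) (+-identityʳ p) (+-monoʳ-≤ p q≥0)

*-÷-cancelˡ : ∀ β .{{_ : NonZero β}} p → (β * p) ÷ β ≡ p
*-÷-cancelˡ β p = begin
  (β * p) * 1/ β  ≡⟨ cong (_* 1/ β) (*-comm β p) ⟩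
  (p * β) * 1/ β  ≡⟨ *-assoc p β (1/ β) ⟩
  p * (β * 1/ β)  ≡⟨ cong (p *_) (*-inverseʳ β) ⟩
  p * 1ℚ          ≡⟨ *-identityʳ p ⟩
  p               ∎
  where open ≡-Reasoning

÷-monoˡ-≤ : ∀ β .{{_ : NonZero β}} → 0ℚ < β → ∀ {p q} → p ≤ q → p ÷ β ≤ q ÷ β
÷-monoˡ-≤ β {{β≢0}} β>0 = *-monoʳ-≤-nonNeg (1/ β) {{pos⇒nonNeg ((1/ β) {{β≢0}}) {{1/β>0}}}}
  where
  1/β>0 : Positive ((1/ β) {{pos⇒nonZero β {{positive β>0}}}})
  1/β>0 = 1/pos⇒pos β {{positive β>0}}

p≤a*p : ∀ {a p} → 1ℚ ≤ a → 0ℚ ≤ p → p ≤ a * p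
p≤a*p {a} {p} 1≤a 0≤p = subst (_≤ a * p) (*-identityˡ p) (*-monoʳ-≤-nonNeg p {{nonNegative 0≤p}} 1≤a)

β*p≤q⇒p*r≤q*r÷β : ∀ β .{{_ : NonZero β}} → 0ℚ < β → ∀ {p q r} → 0ℚ ≤ r → β * p ≤ q → p * r ≤ (q * r) ÷ β
β*p≤q⇒p*r≤q*r÷β β β>0 {p} {q} {r} 0≤r βp≤q = begin
  p * r               ≡⟨ sym (*-÷-cancelˡ β (p * r)) ⟩
  (β * (p * r)) ÷ β   ≡⟨ cong (_* 1/ β) (sym (*-assoc β p r)) ⟩
  ((β * p) * r) ÷ β   ≤⟨ ÷-monoˡ-≤ β β>0 (*-monoʳ-≤-nonNeg r {{nonNegative 0≤r}} βp≤q) ⟩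
  (q * r) ÷ β         ∎
  where open ≤-Reasoning

foldr-map-allFin-suc : ∀ (_∙_ : ℚ → ℚ → ℚ) (e : ℚ) (f : Fin (suc n) → ℚ) →
  foldr _∙_ e (map f (allFin (suc n))) ≡ f zero ∙ foldr _∙_ e (map (f ∘ suc) (allFin n))
foldr-map-allFin-suc _∙_ e f =
  cong (λ xs → f zero ∙ foldr _∙_ e xs) (trans (map-tabulate suc f) (sym (map-tabulate id (f ∘ suc))))

maxFin-suc : (f : Fin (suc n) → ℚ) → maxFin f ≡ f zero ⊔ maxFin (f ∘ suc)
maxFin-suc = foldr-map-allFin-suc _⊔_ 0ℚ

sumFin-suc : (f : Fin (suc n) → ℚ) → sumFin f ≡ f zero + sumFin (f ∘ suc)
sumFin-suc = foldr-map-allFin-suc _+_ 0ℚ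

0≤maxFin : (f : Fin n → ℚ) → 0ℚ ≤ maxFin f
0≤maxFin {zero}  f = ≤-refl
0≤maxFin {suc n} f rewrite maxFin-suc f = ≤-trans (0≤maxFin (f ∘ suc)) (p≤q⊔p (f zero) _)

f≤maxFin : (f : Fin n → ℚ) (i : Fin n) → f i ≤ maxFin f
f≤maxFin f zero    rewrite maxFin-suc f = p≤p⊔q (f zero) _
f≤maxFin f (suc i) rewrite maxFin-suc f = ≤-trans (f≤maxFin (f ∘ suc) i) (p≤q⊔p (f zero) _)

0≤sumFin : (f : Fin n → ℚ) → (∀ i → 0ℚ ≤ f i) → 0ℚ ≤ sumFin f
0≤sumFin {zero}  f f≥0 = ≤-refl
0≤sumFin {suc n} f f≥0 rewrite sumFin-suc f =
  +-mono-≤ (f≥0 zero) (0≤sumFin (f ∘ suc) (f≥0 ∘ suc))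

maxFin≤sumFin : (f : Fin n → ℚ) → (∀ i → 0ℚ ≤ f i) → maxFin f ≤ sumFin f
maxFin≤sumFin {zero}  f f≥0 = ≤-refl
maxFin≤sumFin {suc n} f f≥0 = begin
  maxFin f                        ≡⟨ maxFin-suc f ⟩
  f zero ⊔ maxFin (f ∘ suc)       ≤⟨ ⊔-lub (p≤p+q {f zero} (0≤sumFin (f ∘ suc) (f≥0 ∘ suc)))
                                           (≤-trans (maxFin≤sumFin (f ∘ suc) (f≥0 ∘ suc)) (p≤q+p {sumFin (f ∘ suc)} (f≥0 zero))) ⟩
  f zero + sumFin (f ∘ suc)       ≡⟨ sym (sumFin-suc f) ⟩
  sumFin f                        ∎
  where open ≤-Reasoning

sumFin≤card*bound : (C : Subset n) (f : Fin n → ℚ) {M : ℚ} → 0ℚ ≤ M → ∣ C ∣ ℕ.≤ k →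
  (∀ i → f i ≤ M) → (∀ i → i ∉ C → f i ≡ 0ℚ) → sumFin f ≤ (+ k / 1) * M
sumFin≤card*bound {k = k} [] f {M} M≥0 _ _ _ = begin
  0ℚ              ≡⟨ sym (*-zeroˡ M) ⟩
  0ℚ * M          ≤⟨ *-monoʳ-≤-nonNeg M {{nonNegative M≥0}} (0≤m/1 k) ⟩
  (+ k / 1) * M   ∎
  where open ≤-Reasoning
sumFin≤card*bound (outside ∷ C) f {M} M≥0 ∣C∣≤k f≤M f∉C≡0 = begin
  sumFin f                   ≡⟨ sumFin-suc f ⟩
  f zero + sumFin (f ∘ suc)  ≡⟨ cong (_+ sumFin (f ∘ suc)) (f∉C≡0 zero λ ()) ⟩
  0ℚ + sumFin (f ∘ suc)      ≡⟨ +-identityˡ _ ⟩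
  sumFin (f ∘ suc)           ≤⟨ sumFin≤card*bound C (f ∘ suc) M≥0 ∣C∣≤k (f≤M ∘ suc) (λ i i∉C → f∉C≡0 (suc i) (i∉C ∘ drop-there)) ⟩
  _                          ∎
  where open ≤-Reasoning
sumFin≤card*bound {k = suc k} (inside ∷ C) f {M} M≥0 (ℕ.s≤s ∣C∣≤k) f≤M f∉C≡0 = begin
  sumFin f                     ≡⟨ sumFin-suc f ⟩
  f zero + sumFin (f ∘ suc)    ≤⟨ +-mono-≤ (f≤M zero) (sumFin≤card*bound C (f ∘ suc) M≥0 ∣C∣≤k (f≤M ∘ suc) (λ i i∉C → f∉C≡0 (suc i) (i∉C ∘ drop-there))) ⟩
  M + (+ k / 1) * M            ≡⟨ cong (_+ (+ k / 1) * M) (sym (*-identityˡ M)) ⟩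
  1ℚ * M + (+ k / 1) * M       ≡⟨ sym (*-distribʳ-+ M 1ℚ (+ k / 1)) ⟩
  (1ℚ + + k / 1) * M           ≡⟨ cong (_* M) (sym ([1+m]/1≡1+m/1 k)) ⟩
  (+ suc k / 1) * M            ∎
  where open ≤-Reasoning

module _ {n k} (d : Fin n → Fin n → ℚ) (S : Solution n k) where

  0≤centerRadius : ∀ c → 0ℚ ≤ centerRadius d S c
  0≤centerRadius c with c ∈? centers S
  ... | yes _ = 0≤maxFin (contrib d S c)
  ... | no _  = ≤-refl

  centerRadius-∉ : ∀ c → c ∉ centers S → centerRadius d S c ≡ 0ℚ
  centerRadius-∉ c c∉S with c ∈? centers S
  ... | yes c∈S = contradiction c∈S c∉S
  ... | no _    = refl

  0≤maxRadius : 0ℚ ≤ maxRadius d S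
  0≤maxRadius = 0≤maxFin (centerRadius d S)

  maxRadius≤sumRadii : maxRadius d S ≤ sumRadii d S
  maxRadius≤sumRadii = maxFin≤sumFin (centerRadius d S) 0≤centerRadius

  sumRadii≤k*maxRadius : sumRadii d S ≤ (+ k / 1) * maxRadius d S
  sumRadii≤k*maxRadius = sumFin≤card*bound (centers S) (centerRadius d S)
    0≤maxRadius (atMostK S) (f≤maxFin (centerRadius d S)) centerRadius-∉

module _ {n k} {d : Fin n → Fin n → ℚ} {feas : Constraint n k} where

  betaApprox÷β≤maxRadius : ∀ β .{{_ : NonZero β}} → 0ℚ < β → ∀ {S₀ T} →
    BetaApproxKCenter d feas β S₀ → feas T → maxRadius d S₀ ÷ β ≤ maxRadius d T
  betaApprox÷β≤maxRadius β β>0 {S₀} {T} (_ , approx) feasT = begin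
    maxRadius d S₀ ÷ β          ≤⟨ ÷-monoˡ-≤ β β>0 (approx T feasT) ⟩
    (β * maxRadius d T) ÷ β     ≡⟨ *-÷-cancelˡ β (maxRadius d T) ⟩
    maxRadius d T               ∎
    where open ≤-Reasoning

  optimalMSR-maxRadius≤k*maxRadius : ∀ {S* T} → OptimalMSR d feas S* → feas T →
    maxRadius d S* ≤ (+ k / 1) * maxRadius d T
  optimalMSR-maxRadius≤k*maxRadius {S*} {T} (_ , optimal) feasT = begin
    maxRadius d S*            ≤⟨ maxRadius≤sumRadii d S* ⟩
    sumRadii d S*             ≤⟨ optimal T feasT ⟩
    sumRadii d T              ≤⟨ sumRadii≤k*maxRadius d T ⟩
    (+ k / 1) * maxRadius d T ∎
    where open ≤-Reasoning

bracket-geometric : ∀ {a r} (x : ℕ → ℚ) → 0ℚ ≤ a → (∀ j → x (suc j) ≤ a * x j) →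
  x 0 ≤ a * r → ∀ J → r ≤ x J → Σ ℕ (λ j → (j ℕ.≤ J) × ((r ≤ x j) × (x j ≤ a * r)))
bracket-geometric x a≥0 step x₀≤ar zero r≤x₀ = 0 , ℕ.z≤n , r≤x₀ , x₀≤ar
bracket-geometric {a} {r} x a≥0 step x₀≤ar (suc J) r≤x with r ≤? x J
... | yes r≤xJ = let (j , j≤J , bracket) = bracket-geometric x a≥0 step x₀≤ar J r≤xJ
                 in j , ℕP.m≤n⇒m≤1+n j≤J , bracket
... | no r≰xJ  = suc J , ℕP.≤-refl , r≤x ,
  ≤-trans (step J) (*-monoˡ-≤-nonNeg a {{nonNegative a≥0}} (<⇒≤ (≰⇒> r≰xJ)))

lemma16 : (n k : ℕ) (d : Fin n → Fin n → ℚ) → IsMetric d → 1 ℕ.≤ k →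
          (feas : Constraint n k) → Mergeable feas →
          (β : ℚ) → 1ℚ ≤ β → .{{_ : NonZero β}} →
          (S₀ : Solution n k) → BetaApproxKCenter d feas β S₀ →
          (S* : Solution n k) → OptimalMSR d feas S* →
          (ε : ℚ) → 0ℚ < ε →
          (J : ℕ) → IsCeilLog (1ℚ + ε) (β * (+ k / 1)) J →
          Σ ℕ (λ j → (j ℕ.≤ J) ×
            ((maxRadius d S* ≤ (((1ℚ + ε) ^ℚ j) * maxRadius d S₀) ÷ β) ×
             ((((1ℚ + ε) ^ℚ j) * maxRadius d S₀) ÷ β ≤ (1ℚ + ε) * maxRadius d S*)))
lemma16 n k d _ _ feas _ β 1≤β S₀ approx S* optimal ε ε>0 J (βk≤aᴶ , _) =
  bracket-geometric x 0≤a x-step x₀≤ar J r≤xᴶ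
  where
  a = 1ℚ + ε
  F = maxRadius d S₀
  r = maxRadius d S*
  x : ℕ → ℚ
  x j = ((a ^ℚ j) * F) ÷ β
  β>0 : 0ℚ < β
  β>0 = <-≤-trans (positive⁻¹ 1ℚ) 1≤β
  1≤a : 1ℚ ≤ a
  1≤a = +-monoʳ-≤ 1ℚ (<⇒≤ ε>0)
  0≤a : 0ℚ ≤ a
  0≤a = ≤-trans (nonNegative⁻¹ 1ℚ) 1≤a
  x-step : ∀ j → x (suc j) ≤ a * x j
  x-step j = ≤-reflexive (trans (cong (_* 1/ β) (*-assoc a (a ^ℚ j) F)) (*-assoc a _ (1/ β)))
  x₀≤ar : x 0 ≤ a * r
  x₀≤ar = ≤-trans (≤-reflexive (cong (_* 1/ β) (*-identityˡ F)))
            (≤-trans (betaApprox÷β≤maxRadius β β>0 approx (proj₁ optimal)) (p≤a*p 1≤a (0≤maxRadius d S*)))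
  r≤xᴶ : r ≤ x J
  r≤xᴶ = ≤-trans (optimalMSR-maxRadius≤k*maxRadius optimal (proj₁ approx))
            (β*p≤q⇒p*r≤q*r÷β β β>0 (0≤maxRadius d S₀) βk≤aᴶ)
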